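{- Let $n$ and $k$ be integers with $n\ge 1$ and $0\le k\le n$. Then $\gamma(n,n-k)=\delta(n,k)$.
   Context: $\Lambda_n^k$ is the set of $n\times n$ matrices with entries in $\{0,1\}$ having exactly $k$ entries equal to $1$ in each row and each column. For a binary $n\times n$ matrix $A=(a_{ij})$ let $x_i=\sum_{j=1}^n a_{ij}2^{n-j}$ (row $i$ read as a binary number) and $y_j=\sum_{i=1}^n a_{ij}2^{n-i}$ (column $j$ read as a binary number). $\mathfrak{C}_{n\times n}$ is the set of binary $n\times n$ matrices with $x_1\le\cdots\le x_n$ and $y_1\le\cdots\le y_n$; $\mathfrak{D}_{n\times n}$ is the set with $x_1\ge\cdots\ge x_n$ and $y_1\ge\cdots\ge y_n$. $\Gamma_n^k=\mathfrak{C}_{n\times n}\cap\Lambda_n^k$, $\Delta_n^k=\mathfrak{D}_{n\times n}\cap\Lambda_n^k$, $\gamma(n,k)=|\Gamma_n^k|$, $\delta(n,k)=|\Delta_n^k|$. -}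

module Defs where

open import Data.Bool using (Bool; true; false; _∧_; if_then_else_)
open import Data.Nat using (ℕ; zero; suc; _+_; _*_; _≡ᵇ_; _≤ᵇ_)
open import Data.List using (List; []; _∷_; length; filter; concatMap; map)
open import Data.Vec using (Vec; []; _∷_; toList; transpose; foldl)
open import Function using (_∘_)
open import Relation.Nullary.Decidable using (Dec)
open import Data.Bool using (T?)

-- A binary n×n matrix, given as a vector of n rows, each a vector of n bits.
-- Entry a_ij is the j-th entry of the i-th row (true = 1, false = 0).
Matrix : ℕ → Set
Matrix n = Vec (Vec Bool n) n

allVecs : {A : Set} → List A → (m : ℕ) → List (Vec A m)
allVecs xs zero = [] ∷ []
allVecs xs (suc m) = concatMap (λ x → map (x ∷_) (allVecs xs m)) xs

allMatrices : (n : ℕ) → List (Matrix n)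
allMatrices n = allVecs (allVecs (false ∷ true ∷ []) n) n

bit : Bool → ℕ
bit true = 1
bit false = 0

-- Read a bit vector (b_1,…,b_m) as the binary number Σ_j b_j 2^(m-j)
-- (first entry most significant).
binVal : {m : ℕ} → Vec Bool m → ℕ
binVal = foldl (λ _ → ℕ) (λ acc b → 2 * acc + bit b) 0

ones : {m : ℕ} → Vec Bool m → ℕ
ones v = length (filter (T? ∘ (λ b → b)) (toList v))

rowVals : {n : ℕ} → Matrix n → List ℕ
rowVals A = toList (Data.Vec.map binVal A)

colVals : {n : ℕ} → Matrix n → List ℕ
colVals A = toList (Data.Vec.map binVal (transpose A))

nondecr : List ℕ → Bool
nondecr [] = true
nondecr (x ∷ []) = true
nondecr (x ∷ y ∷ xs) = (x ≤ᵇ y) ∧ nondecr (y ∷ xs)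

nonincr : List ℕ → Bool
nonincr [] = true
nonincr (x ∷ []) = true
nonincr (x ∷ y ∷ xs) = (y ≤ᵇ x) ∧ nonincr (y ∷ xs)

allB : {A : Set} → (A → Bool) → List A → Bool
allB p [] = true
allB p (x ∷ xs) = p x ∧ allB p xs

inΛ : {n : ℕ} → ℕ → Matrix n → Bool
inΛ k A = allB (λ r → ones r ≡ᵇ k) (toList A)
        ∧ allB (λ c → ones c ≡ᵇ k) (toList (transpose A))

inC : {n : ℕ} → Matrix n → Bool
inC A = nondecr (rowVals A) ∧ nondecr (colVals A)

inD : {n : ℕ} → Matrix n → Bool
inD A = nonincr (rowVals A) ∧ nonincr (colVals A)

γ : ℕ → ℕ → ℕ
γ n k = length (filter (λ A → T? (inC A ∧ inΛ k A)) (allMatrices n))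

δ : ℕ → ℕ → ℕ
δ n k = length (filter (λ A → T? (inD A ∧ inΛ k A)) (allMatrices n))

{-# OPTIONS --safe #-}
-- Complementing every entry, A ↦ J − A, is an involution on binary n×n matrices.
-- It turns k ones per row and column into n − k, and it replaces each row and
-- column value v by 2ⁿ − 1 − v, so it reverses both orders; hence it maps
-- Γ_n^(n−k) bijectively onto Δ_n^k.
module Submission where

open import Defs
open import Data.Nat using (ℕ; _≤_; _∸_)
open import Relation.Binary.PropositionalEquality using (_≡_)

open import Data.Bool using (Bool; true; false; _∧_; not; T; T?)
open import Data.Nat using (zero; suc; _+_; _*_; _^_; _≡ᵇ_)
open import Data.Nat.Properties
  using (_≟_; _≤?_; +-suc; +-cancelʳ-≡; +-cancelˡ-≤; +-cancelʳ-≤; +-monoʳ-≤; +-monoˡ-≤;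
         *-identityˡ; *-assoc; *-comm; m+n∸n≡m; m+n∸m≡n; m∸[m∸n]≡n; ≤-reflexive; ≤-trans)
open import Data.Nat.Tactic.RingSolver using (solve-∀)
open import Data.Product using (_,_)
open import Data.List as List using (List; []; _∷_; length; filter; concatMap)
open import Data.List.Properties as Listₚ using (map-concatMap; concatMap-map; concatMap-cong; filter-≐)
open import Data.List.Relation.Binary.Permutation.Propositional
  using (_↭_; refl; prep; swap; trans; module PermutationReasoning)
open import Data.List.Relation.Binary.Permutation.Propositional.Properties
  using (map⁺; ++⁺; ++⁺ˡ; shifts; ↭-length; filter-↭)
open import Data.Vec as Vec using (Vec; []; _∷_; toList; transpose; replicate; _⊛_)
open import Data.Vec.Properties using (map-replicate; map-∘)
open import Function using (_∘_; _⇔_; mk⇔)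
open import Relation.Nullary.Decidable using (does-⇔)
open import Relation.Binary.PropositionalEquality
  as Eq using (refl; sym; cong; cong₂; subst; _≗_; module ≡-Reasoning)

private
  variable
    A B : Set
    m n l : ℕ

count : (A → Bool) → List A → ℕ
count p = length ∘ filter (T? ∘ p)

count-↭ : (p : A → Bool) {xs ys : List A} → xs ↭ ys → count p xs ≡ count p ys
count-↭ p xs↭ys = ↭-length (filter-↭ (T? ∘ p) xs↭ys)

count-map : (p : B → Bool) (f : A → B) (xs : List A) →
            count p (List.map f xs) ≡ count (p ∘ f) xs
count-map p f []       = refl
count-map p f (x ∷ xs) with p (f x)
... | true  = cong suc (count-map p f xs)
... | false = count-map p f xs

count-cong : {p q : A → Bool} → p ≗ q → (xs : List A) → count p xs ≡ count q xs
count-cong {p = p} {q} p≗q xs =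
  cong length (filter-≐ (T? ∘ p) (T? ∘ q) ((λ {a} → subst T (p≗q a)) , (λ {a} → subst T (sym (p≗q a)))) xs)

concatMap-↭ʳ : {f g : A → List B} → (∀ x → f x ↭ g x) → (xs : List A) →
               concatMap f xs ↭ concatMap g xs
concatMap-↭ʳ f↭g []       = refl
concatMap-↭ʳ f↭g (x ∷ xs) = ++⁺ (f↭g x) (concatMap-↭ʳ f↭g xs)

concatMap-↭ˡ : (f : A → List B) {xs ys : List A} → xs ↭ ys → concatMap f xs ↭ concatMap f ys
concatMap-↭ˡ f refl         = refl
concatMap-↭ˡ f (prep x p)   = ++⁺ˡ (f x) (concatMap-↭ˡ f p)
concatMap-↭ˡ f (swap x y p) = trans (shifts (f x) (f y)) (++⁺ˡ (f y) (++⁺ˡ (f x) (concatMap-↭ˡ f p)))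
concatMap-↭ˡ f (trans p q)  = trans (concatMap-↭ˡ f p) (concatMap-↭ˡ f q)

allVecs-map-↭ : (f : A → B) {xs : List A} {ys : List B} → List.map f xs ↭ ys →
                ∀ m → List.map (Vec.map f) (allVecs xs m) ↭ allVecs ys m
allVecs-map-↭ f fxs↭ys zero    = refl
allVecs-map-↭ f {xs} {ys} fxs↭ys (suc m) = begin
  List.map (Vec.map f) (concatMap (λ x → List.map (x ∷_) V) xs)
    ≡⟨ map-concatMap (Vec.map f) _ xs ⟩
  concatMap (λ x → List.map (Vec.map f) (List.map (x ∷_) V)) xs
    ≡⟨ concatMap-cong (λ x → Eq.trans (sym (Listₚ.map-∘ V)) (Listₚ.map-∘ V)) xs ⟩
  concatMap (λ x → List.map (f x ∷_) (List.map (Vec.map f) V)) xs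
    ↭⟨ concatMap-↭ʳ (λ x → map⁺ (f x ∷_) (allVecs-map-↭ f fxs↭ys m)) xs ⟩
  concatMap (λ x → List.map (f x ∷_) W) xs
    ≡⟨ concatMap-map (λ y → List.map (y ∷_) W) f xs ⟨
  concatMap (λ y → List.map (y ∷_) W) (List.map f xs)
    ↭⟨ concatMap-↭ˡ _ fxs↭ys ⟩
  concatMap (λ y → List.map (y ∷_) W) ys ∎
  where
  open PermutationReasoning
  V = allVecs xs m
  W = allVecs ys m

complement : Matrix n → Matrix n
complement = Vec.map (Vec.map not)

allMatrices-complement-↭ : ∀ n → List.map complement (allMatrices n) ↭ allMatrices n
allMatrices-complement-↭ n =
  allVecs-map-↭ (Vec.map not) (allVecs-map-↭ not (swap true false refl) n) n

zipCons-map : (f : A → B) (as : Vec A l) (ass : Vec (Vec A m) l) →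
              ((replicate l _∷_ ⊛ Vec.map f as) ⊛ Vec.map (Vec.map f) ass)
                ≡ Vec.map (Vec.map f) ((replicate l _∷_ ⊛ as) ⊛ ass)
zipCons-map f []       []         = refl
zipCons-map f (a ∷ as) (as′ ∷ ass) = cong (_ ∷_) (zipCons-map f as ass)

transpose-map-map : (f : A → B) (ass : Vec (Vec A n) m) →
                    transpose (Vec.map (Vec.map f) ass) ≡ Vec.map (Vec.map f) (transpose ass)
transpose-map-map {n = n} f []  = sym (map-replicate (Vec.map f) [] n)
transpose-map-map f (as ∷ ass) rewrite transpose-map-map f ass = zipCons-map f as (transpose ass)

ones-complement : (v : Vec Bool m) → ones v + ones (Vec.map not v) ≡ m
ones-complement []          = refl
ones-complement (true ∷ v)  = cong suc (ones-complement v)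
ones-complement (false ∷ v) = Eq.trans (+-suc (ones v) _) (cong suc (ones-complement v))

sum-≡-⇔-∸ : ∀ {o o′ n k} → o + o′ ≡ n → k ≤ n → o′ ≡ k ⇔ o ≡ n ∸ k
sum-≡-⇔-∸ {o} {o′} {n} {k} o+o′≡n k≤n = mk⇔ to from
  where
  open ≡-Reasoning
  to : o′ ≡ k → o ≡ n ∸ k
  to refl = begin
    o            ≡⟨ m+n∸n≡m o o′ ⟨
    o + o′ ∸ o′  ≡⟨ cong (_∸ o′) o+o′≡n ⟩
    n ∸ o′       ∎
  from : o ≡ n ∸ k → o′ ≡ k
  from refl = begin
    o′                       ≡⟨ m+n∸m≡n (n ∸ k) o′ ⟨
    (n ∸ k) + o′ ∸ (n ∸ k)   ≡⟨ cong (_∸ (n ∸ k)) o+o′≡n ⟩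
    n ∸ (n ∸ k)              ≡⟨ m∸[m∸n]≡n k≤n ⟩
    k                        ∎

allB-ones-complement : ∀ {k} → k ≤ n → (rs : Vec (Vec Bool n) l) →
  allB (λ r → ones r ≡ᵇ k) (toList (Vec.map (Vec.map not) rs))
    ≡ allB (λ r → ones r ≡ᵇ n ∸ k) (toList rs)
allB-ones-complement k≤n []       = refl
allB-ones-complement {k = k} k≤n (r ∷ rs) = cong₂ _∧_
  (does-⇔ (sum-≡-⇔-∸ (ones-complement r) k≤n) (ones (Vec.map not r) ≟ k) (ones r ≟ _ ∸ k))
  (allB-ones-complement k≤n rs)

inΛ-complement : ∀ {k} → k ≤ n → (A : Matrix n) → inΛ k (complement A) ≡ inΛ (n ∸ k) A
inΛ-complement k≤n A rewrite transpose-map-map not A =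
  cong₂ _∧_ (allB-ones-complement k≤n A) (allB-ones-complement k≤n (transpose A))

-- binVal = binValFrom 0; the accumulator makes the induction go through.
binValFrom : ℕ → Vec Bool m → ℕ
binValFrom = Vec.foldl (λ _ → ℕ) (λ acc b → 2 * acc + bit b)

appendBits-complement : ∀ b a a′ → 2 * a + bit b + (2 * a′ + bit (not b)) + 1 ≡ 2 * (a + a′ + 1)
appendBits-complement true  = solve-∀
appendBits-complement false = solve-∀

binValFrom-complement : ∀ a a′ (v : Vec Bool m) →
  binValFrom a v + binValFrom a′ (Vec.map not v) + 1 ≡ 2 ^ m * (a + a′ + 1)
binValFrom-complement a a′ []      = sym (*-identityˡ _)
binValFrom-complement {suc m} a a′ (b ∷ v) = begin
  binValFrom (2 * a + bit b) v + binValFrom (2 * a′ + bit (not b)) (Vec.map not v) + 1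
    ≡⟨ binValFrom-complement _ _ v ⟩
  2 ^ m * (2 * a + bit b + (2 * a′ + bit (not b)) + 1)
    ≡⟨ cong (2 ^ m *_) (appendBits-complement b a a′) ⟩
  2 ^ m * (2 * (a + a′ + 1))
    ≡⟨ *-assoc (2 ^ m) 2 _ ⟨
  2 ^ m * 2 * (a + a′ + 1)
    ≡⟨ cong (_* (a + a′ + 1)) (*-comm (2 ^ m) 2) ⟩
  2 ^ suc m * (a + a′ + 1) ∎
  where open ≡-Reasoning

binVal-complement-constant : (u v : Vec Bool m) →
  binVal u + binVal (Vec.map not u) ≡ binVal v + binVal (Vec.map not v)
binVal-complement-constant u v = +-cancelʳ-≡ 1 _ _
  (Eq.trans (binValFrom-complement 0 0 u) (sym (binValFrom-complement 0 0 v)))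

sum-≡-⇔-≤ : ∀ {x x′ y y′} → x + x′ ≡ y + y′ → y′ ≤ x′ ⇔ x ≤ y
sum-≡-⇔-≤ {x} {x′} {y} {y′} eq = mk⇔
  (λ y′≤x′ → +-cancelʳ-≤ x′ x y (≤-trans (≤-reflexive eq) (+-monoʳ-≤ y y′≤x′)))
  (λ x≤y → +-cancelˡ-≤ y y′ x′ (≤-trans (≤-reflexive (sym eq)) (+-monoˡ-≤ x′ x≤y)))

nonincr-≡-nondecr : (f g : A → ℕ) → (∀ a b → f a + g a ≡ f b + g b) → (xs : Vec A l) →
                    nonincr (toList (Vec.map g xs)) ≡ nondecr (toList (Vec.map f xs))
nonincr-≡-nondecr f g const []           = refl
nonincr-≡-nondecr f g const (x ∷ [])     = refl
nonincr-≡-nondecr f g const (x ∷ y ∷ xs) = cong₂ _∧_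
  (does-⇔ (sum-≡-⇔-≤ (const x y)) (g y ≤? g x) (f x ≤? f y))
  (nonincr-≡-nondecr f g const (y ∷ xs))

nonincr-binVal-complement : (rs : Vec (Vec Bool m) l) →
  nonincr (toList (Vec.map binVal (Vec.map (Vec.map not) rs))) ≡ nondecr (toList (Vec.map binVal rs))
nonincr-binVal-complement rs = Eq.trans
  (cong (nonincr ∘ toList) (sym (map-∘ binVal (Vec.map not) rs)))
  (nonincr-≡-nondecr binVal (binVal ∘ Vec.map not) binVal-complement-constant rs)

inD-complement : (A : Matrix n) → inD (complement A) ≡ inC A
inD-complement A rewrite transpose-map-map not A =
  cong₂ _∧_ (nonincr-binVal-complement A) (nonincr-binVal-complement (transpose A))

theorem1 : (n k : ℕ) → 1 ≤ n → k ≤ n → γ n (n ∸ k) ≡ δ n k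
theorem1 n k _ k≤n = begin
  count (λ A → inC A ∧ inΛ (n ∸ k) A) (allMatrices n)
    ≡⟨ count-cong complement-swaps (allMatrices n) ⟨
  count (λ A → inD (complement A) ∧ inΛ k (complement A)) (allMatrices n)
    ≡⟨ count-map (λ A → inD A ∧ inΛ k A) complement (allMatrices n) ⟨
  count (λ A → inD A ∧ inΛ k A) (List.map complement (allMatrices n))
    ≡⟨ count-↭ (λ A → inD A ∧ inΛ k A) (allMatrices-complement-↭ n) ⟩
  count (λ A → inD A ∧ inΛ k A) (allMatrices n) ∎
  where
  open ≡-Reasoning
  complement-swaps : (λ A → inD (complement A) ∧ inΛ k (complement A)) ≗ (λ A → inC A ∧ inΛ (n ∸ k) A)
  complement-swaps A = cong₂ _∧_ (inD-complement A) (inΛ-complement k≤n A)
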